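{- Let $G$ be a finite transitive permutation group with a non-trivial abelian normal subgroup $N$ that has at most two orbits. Then $N$ contains a non-identity semiregular element.
   Context: A permutation is semiregular if the group it generates has no non-identity element fixing a point (equivalently, all its cycles have the same length). -}

module Defs where

open import Level using (Level)
open import Data.Empty using (⊥)
open import Data.Nat.Base using (ℕ; zero; suc)
open import Data.Integer.Base using (ℤ; +_; -[1+_])
open import Data.Fin.Base using (Fin)
open import Data.Fin.Permutation using (Permutation′; _⟨$⟩ʳ_; _≈_; id; flip; _∘ₚ_)
open import Data.Product.Base using (_×_; Σ; ∃; _,_)
open import Data.Sum.Base using (_⊎_)
open import Relation.Binary.PropositionalEquality using (_≡_; _≢_)

-- Finiteness is automatic since Sym(Fin n) is finite.
record IsPermGroup {ℓ : Level} (n : ℕ) (G : Permutation′ n → Set ℓ) : Set ℓ where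
  field
    resp  : ∀ {σ τ} → σ ≈ τ → G σ → G τ
    hasId : G id
    comp  : ∀ {σ τ} → G σ → G τ → G (σ ∘ₚ τ)
    inv   : ∀ {σ} → G σ → G (flip σ)

_^ℕ_ : ∀ {n} → Permutation′ n → ℕ → Permutation′ n
σ ^ℕ zero  = id
σ ^ℕ suc k = σ ∘ₚ (σ ^ℕ k)

_^ℤ_ : ∀ {n} → Permutation′ n → ℤ → Permutation′ n
σ ^ℤ (+ k)     = σ ^ℕ k
σ ^ℤ -[1+ k ]  = flip σ ^ℕ suc k

IsIdentity : ∀ {n} → Permutation′ n → Set
IsIdentity σ = ∀ i → σ ⟨$⟩ʳ i ≡ i

Semiregular : ∀ {n} → Permutation′ n → Set
Semiregular σ = ∀ (k : ℤ) (i : Fin _) → (σ ^ℤ k) ⟨$⟩ʳ i ≡ i → IsIdentity (σ ^ℤ k)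

_⊆_ : ∀ {ℓ₁ ℓ₂ n} → (Permutation′ n → Set ℓ₁) → (Permutation′ n → Set ℓ₂) → Set _
H ⊆ G = ∀ {σ} → H σ → G σ

IsTransitive : ∀ {ℓ n} → (Permutation′ n → Set ℓ) → Set ℓ
IsTransitive {n = n} G = ∀ (i j : Fin n) → ∃ λ σ → G σ × σ ⟨$⟩ʳ i ≡ j

-- N is normal in G (conjugation g h g⁻¹; note σ ∘ₚ τ means "first σ then τ")
IsNormalIn : ∀ {ℓ₁ ℓ₂ n} → (Permutation′ n → Set ℓ₁) → (Permutation′ n → Set ℓ₂) → Set _
IsNormalIn N G = ∀ {g h} → G g → N h → N (flip g ∘ₚ (h ∘ₚ g))

IsAbelian : ∀ {ℓ n} → (Permutation′ n → Set ℓ) → Set ℓ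
IsAbelian N = ∀ {σ τ} → N σ → N τ → (σ ∘ₚ τ) ≈ (τ ∘ₚ σ)

IsNontrivial : ∀ {ℓ n} → (Permutation′ n → Set ℓ) → Set ℓ
IsNontrivial N = ∃ λ σ → N σ × (IsIdentity σ → ⊥)

SameOrbit : ∀ {ℓ n} → (Permutation′ n → Set ℓ) → Fin n → Fin n → Set ℓ
SameOrbit N i j = ∃ λ σ → N σ × σ ⟨$⟩ʳ i ≡ j

AtMostTwoOrbits : ∀ {ℓ n} → (Permutation′ n → Set ℓ) → Set ℓ
AtMostTwoOrbits {n = n} N =
  ∀ (x y z : Fin n) → SameOrbit N x y ⊎ SameOrbit N y z ⊎ SameOrbit N x z

-- Otherwise ρ fixes some a and moves some b; taking g ∈ G with
--    g a = b, the conjugate τ = g⁻¹ρg ∈ N fixes b and has order p, and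
--    ρτ ∈ N is fixed-point-free of order p, hence semiregular.
module Submission where

open import Defs
open import Level using (Level)
open import Data.Nat.Base using (ℕ; zero; suc; _+_; _*_; _∸_; _≤_; _!)
open import Data.Nat.Properties using (n<1+n; m∸n+n≡m; <⇒≤; m<n⇒0<n∸m; m∸n≤m; ≤-pred; ≤-trans; _!≢0)
open import Data.Nat.Divisibility using (_∣_; _∣?_; divides; ∣-trans; m∣m*n; m≤n⇒m!∣n!)
open import Data.Nat.Primality using (Prime; prime⇒irreducible)
open import Data.Nat.Primality.Factorisation using (factorise; PrimeFactorisation)
open import Data.Nat.Coprimality using (Coprime; coprime-Bézout)
open import Data.Nat.GCD using (module Bézout)
open import Data.Nat.ListAction using (product)
open import Data.Integer.Base using (+_; -[1+_])
open import Data.Fin.Base using (Fin; toℕ)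
open import Data.Fin.Properties using (pigeonhole; toℕ<n; any?; all?; ¬∀⟶∃¬) renaming (_≟_ to _≟ᶠ_)
open import Data.Fin.Permutation using (Permutation′; _⟨$⟩ʳ_; _⟨$⟩ˡ_; inverseˡ; inverseʳ; id; flip; _∘ₚ_)
open import Data.List.Base using (List; []; _∷_)
open import Data.List.Relation.Unary.All using (All; []; _∷_)
open import Data.Product.Base using (_×_; ∃; ∃₂; _,_)
open import Data.Sum.Base using (inj₁; inj₂)
open import Data.Empty using (⊥-elim)
open import Relation.Nullary using (¬_; Dec; yes; no)
open import Relation.Binary.PropositionalEquality using (_≡_; _≢_; refl; sym; trans; cong; subst)

prime∤⇒coprime : ∀ {p m} → Prime p → ¬ p ∣ m → Coprime p m
prime∤⇒coprime p-prime p∤m (d∣p , d∣m) with prime⇒irreducible p-prime d∣p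
... | inj₁ d≡1  = d≡1
... | inj₂ refl = ⊥-elim (p∤m d∣m)

∣n! : ∀ {d n} → 1 ≤ d → d ≤ n → d ∣ n !
∣n! {suc e} _ d≤n = ∣-trans (m∣m*n (e !)) (m≤n⇒m!∣n! d≤n)

module _ {n : ℕ} where
  private
    Perm = Permutation′ n

  ⟨$⟩ʳ-injective : (σ : Perm) {i j : Fin n} → σ ⟨$⟩ʳ i ≡ σ ⟨$⟩ʳ j → i ≡ j
  ⟨$⟩ʳ-injective σ e = trans (sym (inverseˡ σ)) (trans (cong (σ ⟨$⟩ˡ_) e) (inverseˡ σ))

  isIdentity? : (σ : Perm) → Dec (IsIdentity σ)
  isIdentity? σ = all? (λ i → σ ⟨$⟩ʳ i ≟ᶠ i)

  FixedPointFree : Perm → Set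
  FixedPointFree σ = ∀ i → σ ⟨$⟩ʳ i ≢ i

  -- Pointwise exponent laws.  Recall σ ∘ₚ τ applies σ first, so
  -- σ ^ℕ suc k applies σ and then σ ^ℕ k.

  ^ℕ-+ : (σ : Perm) (a b : ℕ) (y : Fin n) →
         (σ ^ℕ (a + b)) ⟨$⟩ʳ y ≡ (σ ^ℕ b) ⟨$⟩ʳ ((σ ^ℕ a) ⟨$⟩ʳ y)
  ^ℕ-+ σ zero    b y = refl
  ^ℕ-+ σ (suc a) b y = ^ℕ-+ σ a b (σ ⟨$⟩ʳ y)

  ^ℕ-injective : (σ : Perm) (k : ℕ) {i j : Fin n} → (σ ^ℕ k) ⟨$⟩ʳ i ≡ (σ ^ℕ k) ⟨$⟩ʳ j → i ≡ j
  ^ℕ-injective σ zero    e = e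
  ^ℕ-injective σ (suc k) e = ⟨$⟩ʳ-injective σ (^ℕ-injective σ k e)

  ^ℕ-*-fixes : (σ : Perm) (d : ℕ) {i : Fin n} → (σ ^ℕ d) ⟨$⟩ʳ i ≡ i →
               ∀ q → (σ ^ℕ (q * d)) ⟨$⟩ʳ i ≡ i
  ^ℕ-*-fixes σ d         σᵈi≡i zero    = refl
  ^ℕ-*-fixes σ d {i = i} σᵈi≡i (suc q) =
    trans (^ℕ-+ σ d (q * d) i)
          (trans (cong ((σ ^ℕ (q * d)) ⟨$⟩ʳ_) σᵈi≡i) (^ℕ-*-fixes σ d σᵈi≡i q))

  ^ℕ-*-identity : (σ : Perm) (d q : ℕ) → IsIdentity (σ ^ℕ d) → IsIdentity (σ ^ℕ (q * d))
  ^ℕ-*-identity σ d q σᵈ≡id y = ^ℕ-*-fixes σ d (σᵈ≡id y) q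

  ^ℕ-^ℕ : (σ : Perm) (a b : ℕ) (y : Fin n) → ((σ ^ℕ a) ^ℕ b) ⟨$⟩ʳ y ≡ (σ ^ℕ (b * a)) ⟨$⟩ʳ y
  ^ℕ-^ℕ σ a zero    y = refl
  ^ℕ-^ℕ σ a (suc b) y = trans (^ℕ-^ℕ σ a b ((σ ^ℕ a) ⟨$⟩ʳ y)) (sym (^ℕ-+ σ a (b * a) y))

  ^ℕ-comm : (σ τ : Perm) → (∀ y → σ ⟨$⟩ʳ (τ ⟨$⟩ʳ y) ≡ τ ⟨$⟩ʳ (σ ⟨$⟩ʳ y)) →
            ∀ k y → (σ ^ℕ k) ⟨$⟩ʳ (τ ⟨$⟩ʳ y) ≡ τ ⟨$⟩ʳ ((σ ^ℕ k) ⟨$⟩ʳ y)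
  ^ℕ-comm σ τ comm zero    y = refl
  ^ℕ-comm σ τ comm (suc k) y =
    trans (cong ((σ ^ℕ k) ⟨$⟩ʳ_) (comm y)) (^ℕ-comm σ τ comm k (σ ⟨$⟩ʳ y))

  ^ℕ-∘ₚ : (σ τ : Perm) → (∀ y → σ ⟨$⟩ʳ (τ ⟨$⟩ʳ y) ≡ τ ⟨$⟩ʳ (σ ⟨$⟩ʳ y)) →
          ∀ k y → ((σ ∘ₚ τ) ^ℕ k) ⟨$⟩ʳ y ≡ (τ ^ℕ k) ⟨$⟩ʳ ((σ ^ℕ k) ⟨$⟩ʳ y)
  ^ℕ-∘ₚ σ τ comm zero    y = refl
  ^ℕ-∘ₚ σ τ comm (suc k) y =
    trans (^ℕ-∘ₚ σ τ comm k _) (cong ((τ ^ℕ k) ⟨$⟩ʳ_) (^ℕ-comm σ τ comm k (σ ⟨$⟩ʳ y)))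

  ^ℕ-cancel : (σ τ : Perm) → (∀ y → τ ⟨$⟩ʳ (σ ⟨$⟩ʳ y) ≡ y) →
              ∀ k y → (τ ^ℕ k) ⟨$⟩ʳ ((σ ^ℕ k) ⟨$⟩ʳ y) ≡ y
  ^ℕ-cancel σ τ τσ≡id zero    y = refl
  ^ℕ-cancel σ τ τσ≡id (suc k) y =
    trans (cong (λ z → (τ ^ℕ k) ⟨$⟩ʳ (τ ⟨$⟩ʳ z)) (^ℕ-comm σ σ (λ _ → refl) k y))
          (trans (cong ((τ ^ℕ k) ⟨$⟩ʳ_) (τσ≡id _)) (^ℕ-cancel σ τ τσ≡id k y))

  conjugate : Perm → Perm → Perm
  conjugate g ρ = flip g ∘ₚ (ρ ∘ₚ g)

  conjugate-fixes : (g ρ : Perm) {a : Fin n} → ρ ⟨$⟩ʳ a ≡ a → conjugate g ρ ⟨$⟩ʳ (g ⟨$⟩ʳ a) ≡ g ⟨$⟩ʳ a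
  conjugate-fixes g ρ ρa≡a = trans (cong (λ z → g ⟨$⟩ʳ (ρ ⟨$⟩ʳ z)) (inverseˡ g)) (cong (g ⟨$⟩ʳ_) ρa≡a)

  conjugate-nonIdentity : (g ρ : Perm) → ¬ IsIdentity ρ → ¬ IsIdentity (conjugate g ρ)
  conjugate-nonIdentity g ρ ρ≢id conj≡id = ρ≢id λ y →
    ⟨$⟩ʳ-injective g (trans (cong (λ z → g ⟨$⟩ʳ (ρ ⟨$⟩ʳ z)) (sym (inverseˡ g))) (conj≡id (g ⟨$⟩ʳ y)))

  ^ℕ-conjugate : (g ρ : Perm) → ∀ k y →
                 (conjugate g ρ ^ℕ k) ⟨$⟩ʳ y ≡ g ⟨$⟩ʳ ((ρ ^ℕ k) ⟨$⟩ʳ (g ⟨$⟩ˡ y))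
  ^ℕ-conjugate g ρ zero    y = sym (inverseʳ g)
  ^ℕ-conjugate g ρ (suc k) y =
    trans (^ℕ-conjugate g ρ k _) (cong (λ z → g ⟨$⟩ʳ ((ρ ^ℕ k) ⟨$⟩ʳ z)) (inverseˡ g))

  conjugate-^ℕ-identity : (g ρ : Perm) (k : ℕ) → IsIdentity (ρ ^ℕ k) → IsIdentity (conjugate g ρ ^ℕ k)
  conjugate-^ℕ-identity g ρ k ρᵏ≡id y =
    trans (^ℕ-conjugate g ρ k y) (trans (cong (g ⟨$⟩ʳ_) (ρᵏ≡id _)) (inverseʳ g))

  -- Every permutation of Fin n satisfies x ^ n! = id: each point returns
  -- to itself after some d ≤ n steps (pigeonhole on x⁰ i, …, xⁿ i), and d ∣ n!.

  returnTime : (x : Perm) (i : Fin n) → ∃ λ d → 1 ≤ d × d ≤ n × (x ^ℕ d) ⟨$⟩ʳ i ≡ i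
  returnTime x i with pigeonhole (n<1+n n) (λ j → (x ^ℕ toℕ j) ⟨$⟩ʳ i)
  ... | j , k , j<k , xʲi≡xᵏi = d , m<n⇒0<n∸m j<k , d≤n , xᵈi≡i
    where
    d : ℕ
    d = toℕ k ∸ toℕ j
    d≤n : d ≤ n
    d≤n = ≤-trans (m∸n≤m (toℕ k) (toℕ j)) (≤-pred (toℕ<n k))
    xᵈi≡i : (x ^ℕ d) ⟨$⟩ʳ i ≡ i
    xᵈi≡i = ^ℕ-injective x (toℕ j) (trans (sym (^ℕ-+ x d (toℕ j) i))
              (trans (cong (λ e → (x ^ℕ e) ⟨$⟩ʳ i) (m∸n+n≡m (<⇒≤ j<k))) (sym xʲi≡xᵏi)))

  ^n!-identity : (x : Perm) → IsIdentity (x ^ℕ (n !))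
  ^n!-identity x i with returnTime x i
  ... | d , 1≤d , d≤n , xᵈi≡i with ∣n! 1≤d d≤n
  ... | divides q n!≡qd = subst (λ e → (x ^ℕ e) ⟨$⟩ʳ i ≡ i) (sym n!≡qd) (^ℕ-*-fixes x d xᵈi≡i q)

  HasPrimeOrder : ℕ → Perm → Set
  HasPrimeOrder p ρ = Prime p × ¬ IsIdentity ρ × IsIdentity (ρ ^ℕ p)

  -- If x ≠ id is killed by a product of primes, some power of x has prime
  -- order: drop primes from the front while x stays killed by the rest.
  primeOrderPower-of : (x : Perm) → ¬ IsIdentity x → (ps : List ℕ) → All Prime ps →
                       IsIdentity (x ^ℕ product ps) → ∃₂ λ p k → HasPrimeOrder p (x ^ℕ k)
  primeOrderPower-of x x≢id []       []                  x¹≡id = ⊥-elim (x≢id x¹≡id)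
  primeOrderPower-of x x≢id (p ∷ ps) (p-prime ∷ ps-prime) xᵖᵠ≡id with isIdentity? (x ^ℕ product ps)
  ... | yes xᵠ≡id = primeOrderPower-of x x≢id ps ps-prime xᵠ≡id
  ... | no  xᵠ≢id = p , product ps , p-prime , xᵠ≢id ,
                    λ y → trans (^ℕ-^ℕ x (product ps) p y) (xᵖᵠ≡id y)

  primeOrderPower : (x : Perm) → ¬ IsIdentity x → ∃₂ λ p k → HasPrimeOrder p (x ^ℕ k)
  primeOrderPower x x≢id =
    primeOrderPower-of x x≢id factors factorsPrime
      (subst (λ m → IsIdentity (x ^ℕ m)) isFactorisation (^n!-identity x))
    where open PrimeFactorisation (factorise (n !) {{n !≢0}})

  consecutive-fixes : (ρ : Perm) (c : ℕ) {i : Fin n} →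
                      (ρ ^ℕ c) ⟨$⟩ʳ i ≡ i → (ρ ^ℕ suc c) ⟨$⟩ʳ i ≡ i → ρ ⟨$⟩ʳ i ≡ i
  consecutive-fixes ρ c ρᶜi≡i ρ¹⁺ᶜi≡i = ^ℕ-injective ρ c (trans ρ¹⁺ᶜi≡i (sym ρᶜi≡i))

  fixingExponent-divisible : ∀ {p} (ρ : Perm) → Prime p → IsIdentity (ρ ^ℕ p) → FixedPointFree ρ →
                             ∀ m {i} → (ρ ^ℕ m) ⟨$⟩ʳ i ≡ i → p ∣ m
  fixingExponent-divisible {p} ρ p-prime ρᵖ≡id ρ-fpf m {i} ρᵐi≡i with p ∣? m
  ... | yes p∣m = p∣m
  ... | no  p∤m = bézoutContradiction (coprime-Bézout (prime∤⇒coprime p-prime p∤m))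
    where
    multipleOf-m : ∀ q → (ρ ^ℕ (q * m)) ⟨$⟩ʳ i ≡ i
    multipleOf-m = ^ℕ-*-fixes ρ m ρᵐi≡i
    multipleOf-p : ∀ q → (ρ ^ℕ (q * p)) ⟨$⟩ʳ i ≡ i
    multipleOf-p q = ^ℕ-*-identity ρ p q ρᵖ≡id i
    -- Either 1 + y m ≡ x p or 1 + x p ≡ y m; both make ρ fix i.
    bézoutContradiction : Bézout.Identity 1 p m → p ∣ m
    bézoutContradiction (Bézout.+- x y 1+ym≡xp) =
      ⊥-elim (ρ-fpf i (consecutive-fixes ρ (y * m) (multipleOf-m y)
                         (subst (λ e → (ρ ^ℕ e) ⟨$⟩ʳ i ≡ i) (sym 1+ym≡xp) (multipleOf-p x))))
    bézoutContradiction (Bézout.-+ x y 1+xp≡ym) =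
      ⊥-elim (ρ-fpf i (consecutive-fixes ρ (x * p) (multipleOf-p x)
                         (subst (λ e → (ρ ^ℕ e) ⟨$⟩ʳ i ≡ i) (sym 1+xp≡ym) (multipleOf-m y))))

  primeOrder-fixedPointFree⇒semiregular : ∀ {p} (ρ : Perm) → Prime p → IsIdentity (ρ ^ℕ p) →
                                          FixedPointFree ρ → Semiregular ρ
  primeOrder-fixedPointFree⇒semiregular ρ p-prime ρᵖ≡id ρ-fpf (+ m) i ρᵐi≡i
    with fixingExponent-divisible ρ p-prime ρᵖ≡id ρ-fpf m ρᵐi≡i
  ... | divides q refl = ^ℕ-*-identity ρ _ q ρᵖ≡id
  primeOrder-fixedPointFree⇒semiregular ρ p-prime ρᵖ≡id ρ-fpf -[1+ m ] i ρ⁻ᵐi≡i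
    with fixingExponent-divisible ρ p-prime ρᵖ≡id ρ-fpf (suc m) ρᵐi≡i
    where
    -- ρ ^ (1 + m) undoes (ρ⁻¹) ^ (1 + m), so it fixes i too.
    ρᵐi≡i : (ρ ^ℕ suc m) ⟨$⟩ʳ i ≡ i
    ρᵐi≡i = trans (cong ((ρ ^ℕ suc m) ⟨$⟩ʳ_) (sym ρ⁻ᵐi≡i))
                  (^ℕ-cancel (flip ρ) ρ (λ _ → inverseʳ ρ) (suc m) i)
  ... | divides q eq = λ y →
    trans (cong ((flip ρ ^ℕ suc m) ⟨$⟩ʳ_) (sym (ρᵐ≡id y))) (^ℕ-cancel ρ (flip ρ) (λ _ → inverseˡ ρ) (suc m) y)
    where
    ρᵐ≡id : IsIdentity (ρ ^ℕ suc m)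
    ρᵐ≡id = subst (λ e → IsIdentity (ρ ^ℕ e)) (sym eq) (^ℕ-*-identity ρ _ q ρᵖ≡id)

  ^ℕ-closed : ∀ {ℓ} {N : Perm → Set ℓ} → IsPermGroup n N → ∀ {x} → N x → ∀ k → N (x ^ℕ k)
  ^ℕ-closed N-group x∈N zero    = IsPermGroup.hasId N-group
  ^ℕ-closed N-group x∈N (suc k) = IsPermGroup.comp N-group x∈N (^ℕ-closed N-group x∈N k)

  module AbelianOrbits {ℓ} {N : Perm → Set ℓ} (N-group : IsPermGroup n N) (N-abelian : IsAbelian N) where

    fixesOrbit : ∀ {τ x y} → N τ → τ ⟨$⟩ʳ x ≡ x → SameOrbit N x y → τ ⟨$⟩ʳ y ≡ y
    fixesOrbit {τ} {x} τ∈N τx≡x (ν , ν∈N , νx≡y) =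
      trans (cong (τ ⟨$⟩ʳ_) (sym νx≡y))
            (trans (N-abelian ν∈N τ∈N x) (trans (cong (ν ⟨$⟩ʳ_) τx≡x) νx≡y))

    sameOrbit-sym : ∀ {x y} → SameOrbit N x y → SameOrbit N y x
    sameOrbit-sym (ν , ν∈N , νx≡y) =
      flip ν , IsPermGroup.inv N-group ν∈N , trans (cong (ν ⟨$⟩ˡ_) (sym νx≡y)) (inverseˡ ν)

    separatesOrbits : ∀ {ρ a b} → N ρ → ρ ⟨$⟩ʳ a ≡ a → ρ ⟨$⟩ʳ b ≢ b → ¬ SameOrbit N a b
    separatesOrbits ρ∈N ρa≡a ρb≢b a∼b = ρb≢b (fixesOrbit ρ∈N ρa≡a a∼b)

    module _ (twoOrbits : AtMostTwoOrbits N) where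

      fixesBothOrbits⇒identity : ∀ {σ a b} → N σ → σ ⟨$⟩ʳ a ≡ a → σ ⟨$⟩ʳ b ≡ b →
                                 ¬ SameOrbit N a b → IsIdentity σ
      fixesBothOrbits⇒identity {a = a} {b} σ∈N σa≡a σb≡b a≁b y with twoOrbits a b y
      ... | inj₁ a∼b        = ⊥-elim (a≁b a∼b)
      ... | inj₂ (inj₁ b∼y) = fixesOrbit σ∈N σb≡b b∼y
      ... | inj₂ (inj₂ a∼y) = fixesOrbit σ∈N σa≡a a∼y

      -- If ρ ∈ N fixes a and moves b, and τ ∈ N ∖ {id} fixes b, then ρτ is
      -- fixed-point-free: on the orbit of a it acts as τ, on that of b as ρ.
      product-fixedPointFree : ∀ {ρ τ a b} → N ρ → N τ → ρ ⟨$⟩ʳ a ≡ a → ρ ⟨$⟩ʳ b ≢ b →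
                               τ ⟨$⟩ʳ b ≡ b → ¬ IsIdentity τ → FixedPointFree (ρ ∘ₚ τ)
      product-fixedPointFree {ρ} {τ} {a} {b} ρ∈N τ∈N ρa≡a ρb≢b τb≡b τ≢id x ψx≡x with twoOrbits a b x
      ... | inj₁ a∼b        = separatesOrbits ρ∈N ρa≡a ρb≢b a∼b
      ... | inj₂ (inj₁ b∼x) = ρb≢b (fixesOrbit ρ∈N ρx≡x (sameOrbit-sym b∼x))
        where
        ρx≡x : ρ ⟨$⟩ʳ x ≡ x
        ρx≡x = ⟨$⟩ʳ-injective τ (trans ψx≡x (sym (fixesOrbit τ∈N τb≡b b∼x)))
      ... | inj₂ (inj₂ a∼x) =
        τ≢id (fixesBothOrbits⇒identity τ∈N τa≡a τb≡b (separatesOrbits ρ∈N ρa≡a ρb≢b))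
        where
        τx≡x : τ ⟨$⟩ʳ x ≡ x
        τx≡x = trans (cong (τ ⟨$⟩ʳ_) (sym (fixesOrbit ρ∈N ρa≡a a∼x))) ψx≡x
        τa≡a : τ ⟨$⟩ʳ a ≡ a
        τa≡a = fixesOrbit τ∈N τx≡x (sameOrbit-sym a∼x)

  semiregularElement : ∀ {ℓ₁ ℓ₂} (G : Perm → Set ℓ₁) (N : Perm → Set ℓ₂) →
    IsTransitive G → IsPermGroup n N → IsNormalIn N G → IsAbelian N → AtMostTwoOrbits N →
    ∀ {p ρ} → N ρ → HasPrimeOrder p ρ → ∃ λ σ → N σ × ¬ IsIdentity σ × Semiregular σ
  semiregularElement G N G-transitive N-group N-normal N-abelian twoOrbits {p} {ρ} ρ∈N (p-prime , ρ≢id , ρᵖ≡id)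
    with any? (λ i → ρ ⟨$⟩ʳ i ≟ᶠ i)
  ... | no ρ-fpf =
    ρ , ρ∈N , ρ≢id , primeOrder-fixedPointFree⇒semiregular ρ p-prime ρᵖ≡id (λ i ρi≡i → ρ-fpf (i , ρi≡i))
  ... | yes (a , ρa≡a) with ¬∀⟶∃¬ n _ (λ i → ρ ⟨$⟩ʳ i ≟ᶠ i) ρ≢id
  ... | b , ρb≢b with G-transitive a b
  ... | g , g∈G , refl =
    ψ , ψ∈N , (λ ψ≡id → ψ-fpf a (ψ≡id a)) , primeOrder-fixedPointFree⇒semiregular ψ p-prime ψᵖ≡id ψ-fpf
    where
    open AbelianOrbits N-group N-abelian
    τ : Perm
    τ = conjugate g ρ
    τ∈N : N τ
    τ∈N = N-normal g∈G ρ∈N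
    ψ : Perm
    ψ = ρ ∘ₚ τ
    ψ∈N : N ψ
    ψ∈N = IsPermGroup.comp N-group ρ∈N τ∈N
    ψ-fpf : FixedPointFree ψ
    ψ-fpf = product-fixedPointFree twoOrbits ρ∈N τ∈N ρa≡a ρb≢b
              (conjugate-fixes g ρ ρa≡a) (conjugate-nonIdentity g ρ ρ≢id)
    ψᵖ≡id : IsIdentity (ψ ^ℕ p)
    ψᵖ≡id y = trans (^ℕ-∘ₚ ρ τ (N-abelian τ∈N ρ∈N) p y)
                    (trans (conjugate-^ℕ-identity g ρ p ρᵖ≡id _) (ρᵖ≡id y))

lemma2p2 : ∀ {ℓ₁ ℓ₂ : Level} (n : ℕ) (G : Permutation′ n → Set ℓ₁) (N : Permutation′ n → Set ℓ₂)
  → IsPermGroup n G → IsTransitive G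
  → IsPermGroup n N → N ⊆ G → IsNormalIn N G → IsAbelian N
  → IsNontrivial N → AtMostTwoOrbits N
  → ∃ λ σ → N σ × ¬ IsIdentity σ × Semiregular σ
lemma2p2 n G N _ G-transitive N-group _ N-normal N-abelian (x , x∈N , x≢id) twoOrbits
  with primeOrderPower x x≢id
... | p , k , ρ-primeOrder =
  semiregularElement G N G-transitive N-group N-normal N-abelian twoOrbits (^ℕ-closed N-group x∈N k) ρ-primeOrder
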